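{- Let $e\ge2$, $c\in\mathbb Z$, $i\in\{0,\dots,e-1\}$, and let $\lambda,\mu$ be $c$-charged $e$-cores such that $\mu$ has no addable $i$-nodes. Then $Y(\lambda)\subseteq Y(\mu)$ if and only if $Y(s_i\lambda)\subseteq Y(\mu)$.
   Context: A $c$-charged partition is a partition $\lambda=(\lambda_1\ge\dots\ge\lambda_h>0)$ with an integer $c$; $Y(\lambda)=\{(a,b):1\le a\le h,1\le b\le\lambda_a\}$; its abacus is $\{\lambda_k-k+c+1:k\ge1\}$ ($\lambda_k=0$ for $k>h$). It is an $e$-core if its abacus $A$ satisfies $x\in A\Rightarrow x-e\in A$. The residue of node $(a,b)$ is $b-a+c\bmod e$; an $i$-node has residue $i$. Addable/removable nodes: $\gamma\notin Y(\lambda)$ with $Y(\lambda)\cup\{\gamma\}$ a Young diagram / $\gamma\in Y(\lambda)$ with $Y(\lambda)\setminus\{\gamma\}$ a Young diagram. The generator $s_i$ of the affine symmetric group acts on a $c$-charged $e$-core $\lambda$ by adding all its addable $i$-nodes (if it has any) or removing all its removable $i$-nodes (equivalently, $s_i\lambda$ has abacus $s_i(A)$, where $s_i$ swaps $i+ke$ and $i+1+ke$ for all $k\in\mathbb Z$). -}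

module Defs where

open import Data.Nat using (ℕ; zero; suc; _≤_; _≥_; _>_; NonZero)
open import Data.Integer as ℤ using (ℤ; +_; _%ℕ_)
open import Data.List using (List; []; _∷_; length)
open import Data.List.Relation.Unary.All using (All)
open import Data.List.Relation.Unary.Linked using (Linked)
open import Data.Product using (Σ; ∃; _×_; _,_)
open import Data.Sum using (_⊎_)
open import Relation.Binary.PropositionalEquality using (_≡_; _≢_)
open import Relation.Nullary using (¬_)
open import Function.Bundles using (_⇔_)

record Partition : Set where
  field
    parts : List ℕ
    decr  : Linked _≥_ parts
    pos   : All (λ x → x > 0) parts
open Partition public

-- 1-indexed part λ_k, with λ_k = 0 for k > h (and for k = 0, unused).
partL : List ℕ → ℕ → ℕ
partL []       _             = 0
partL (x ∷ xs) zero          = 0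
partL (x ∷ xs) (suc zero)    = x
partL (x ∷ xs) (suc (suc k)) = partL xs (suc k)

part : Partition → ℕ → ℕ
part p k = partL (parts p) k

Node : Set
Node = ℕ × ℕ

NodeSet : Set₁
NodeSet = Node → Set

_⊆_ : NodeSet → NodeSet → Set
S ⊆ T = ∀ n → S n → T n

Y : Partition → NodeSet
Y p (a , b) = (1 ≤ a × a ≤ length (parts p)) × (1 ≤ b × b ≤ part p a)

IsYoungDiagram : NodeSet → Set
IsYoungDiagram S = ∃ λ ν → ∀ n → S n ⇔ Y ν n

Addable : Partition → Node → Set
Addable p γ = ¬ Y p γ × IsYoungDiagram (λ n → Y p n ⊎ n ≡ γ)

Removable : Partition → Node → Set
Removable p γ = Y p γ × IsYoungDiagram (λ n → Y p n × n ≢ γ)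

residue : (e : ℕ) .{{_ : NonZero e}} → ℤ → Node → ℕ
residue e c (a , b) = ((+ b ℤ.- + a) ℤ.+ c) %ℕ e

IsINode : (e : ℕ) .{{_ : NonZero e}} → ℤ → ℕ → Node → Set
IsINode e c i γ = residue e c γ ≡ i

Abacus : Partition → ℤ → ℤ → Set
Abacus p c x = ∃ λ k → 1 ≤ k × x ≡ ((+ part p k ℤ.- + k) ℤ.+ c) ℤ.+ + 1

IsCore : ℕ → ℤ → Partition → Set
IsCore e c p = ∀ x → Abacus p c x → Abacus p c (x ℤ.- + e)

IsSiAction : (e : ℕ) .{{_ : NonZero e}} → ℤ → ℕ → Partition → Partition → Set
IsSiAction e c i p ν =
  ((∃ λ γ → Addable p γ × IsINode e c i γ) →
     ∀ n → Y ν n ⇔ (Y p n ⊎ (Addable p n × IsINode e c i n)))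
  × ((¬ ∃ λ γ → Addable p γ × IsINode e c i γ) →
     ∀ n → Y ν n ⇔ (Y p n × ¬ (Removable p n × IsINode e c i n)))

-- A node outside Y(μ) whose upper and left neighbours lie in Y(μ) is addable to μ, so by
-- hypothesis it is not an i-node. If s_i adds nodes then Y(λ) ⊆ Y(s_i λ), and when
-- Y(λ) ⊆ Y(μ) every added node has its neighbours in Y(μ), hence lies in Y(μ). If s_i removes
-- nodes then Y(s_i λ) ⊆ Y(λ); a removed node is an i-node while its neighbours have residue
-- i ± 1 ≠ i (as e ≥ 2), so they survive in s_i λ, and when Y(s_i λ) ⊆ Y(μ) the removed node
-- lies in Y(μ) too.
module Submission where

open import Defs
open import Data.Nat using (ℕ; _≤_; _<_; NonZero)
open import Data.Integer using (ℤ)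
open import Data.Product using (∃; _×_)
open import Relation.Nullary using (¬_)
open import Function.Bundles using (_⇔_)

open import Data.Nat as ℕ using (zero; suc; s≤s; z≤n; _≤?_; _≥_; _>_)
open import Data.Nat.Properties using (≤-refl; ≤-trans; ≤-antisym; m≤n⇒m≤1+n; n≤1+n; ≰⇒>; m*n≡1⇒n≡1)
open import Data.Integer using (+_; _+_; _-_; _*_; ∣_∣; _%ℕ_; _/ℕ_)
open import Data.Integer.DivMod using (a≡a%ℕn+[a/ℕn]*n)
open import Data.Integer.Properties using (abs-*; pos-+)
open import Data.Integer.Tactic.RingSolver using (solve-∀)
open import Data.Empty using (⊥-elim)
open import Data.List using (List; []; _∷_; length)
open import Data.List.Relation.Unary.All as All using (All; []; _∷_)
open import Data.List.Relation.Unary.Linked as Linked using (Linked; [-]; _∷_)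
open import Data.Product using (_,_; proj₁; proj₂; map₁)
open import Data.Sum as Sum using (_⊎_; inj₁; inj₂; [_,_])
open import Function using (_∘_)
open import Function.Bundles using (mk⇔; Equivalence)
open import Relation.Binary.PropositionalEquality
  using (_≡_; _≢_; refl; sym; trans; cong; cong₂; subst; module ≡-Reasoning)
open import Relation.Nullary using (Dec; yes; no)
open import Relation.Nullary.Decidable using (_×-dec_; decidable-stable)

by-cases : {P Q : Set} → Dec P → (Q → P) → (¬ Q → P) → P
by-cases P? q⇒p ¬q⇒p = decidable-stable P? (λ ¬p → ¬p (¬q⇒p (¬p ∘ q⇒p)))

x%e≡y%e⇒x-y≡[x/e-y/e]*e : ∀ x y e .{{_ : NonZero e}} → x %ℕ e ≡ y %ℕ e →
                           x - y ≡ (x /ℕ e - y /ℕ e) * + e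
x%e≡y%e⇒x-y≡[x/e-y/e]*e x y e eq = begin
  x - y
    ≡⟨ cong₂ _-_ (a≡a%ℕn+[a/ℕn]*n x e) (a≡a%ℕn+[a/ℕn]*n y e) ⟩
  (+ (x %ℕ e) + x /ℕ e * + e) - (+ (y %ℕ e) + y /ℕ e * + e)
    ≡⟨ cong (λ r → (+ r + x /ℕ e * + e) - (+ (y %ℕ e) + y /ℕ e * + e)) eq ⟩
  (+ (y %ℕ e) + x /ℕ e * + e) - (+ (y %ℕ e) + y /ℕ e * + e)
    ≡⟨ cancel (+ (y %ℕ e)) (x /ℕ e) (y /ℕ e) (+ e) ⟩
  (x /ℕ e - y /ℕ e) * + e ∎
  where
  open ≡-Reasoning
  cancel : ∀ r p q d → (r + p * d) - (r + q * d) ≡ (p - q) * d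
  cancel = solve-∀

[z+1]%e≢z%e : ∀ e .{{_ : NonZero e}} → 2 ≤ e → ∀ z → (z + + 1) %ℕ e ≢ z %ℕ e
[z+1]%e≢z%e e 2≤e z eq with m*n≡1⇒n≡1 ∣ q ∣ e (sym 1≡∣q∣*e)
  where
  q : ℤ
  q = (z + + 1) /ℕ e - z /ℕ e
  1≡∣q∣*e : 1 ≡ ∣ q ∣ ℕ.* e
  1≡∣q∣*e = begin
    ∣ + 1 ∣                 ≡⟨ cong ∣_∣ (sym (+1-cancel z)) ⟩
    ∣ (z + + 1) - z ∣       ≡⟨ cong ∣_∣ (x%e≡y%e⇒x-y≡[x/e-y/e]*e (z + + 1) z e eq) ⟩
    ∣ q * + e ∣             ≡⟨ abs-* q (+ e) ⟩
    ∣ q ∣ ℕ.* e             ∎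
    where
    open ≡-Reasoning
    +1-cancel : ∀ x → (x + + 1) - x ≡ + 1
    +1-cancel = solve-∀
... | refl with 2≤e
...   | s≤s ()

data _⋖_ : Node → Node → Set where
  above : ∀ {a b} → (suc a , b) ⋖ (suc (suc a) , b)
  left  : ∀ {a b} → (a , suc b) ⋖ (a , suc (suc b))

⋖-irrefl : ∀ {γ} → ¬ γ ⋖ γ
⋖-irrefl ()

content : ℤ → Node → ℤ
content c (a , b) = (+ b - + a) + c

content-above : ∀ c a b → content c (suc a , b) ≡ content c (suc (suc a) , b) + + 1
content-above c a b = begin
  (+ b - + suc a) + c                   ≡⟨ shift (+ b) (+ suc a) c ⟩
  ((+ b - (+ 1 + + suc a)) + c) + + 1   ≡⟨ cong (λ t → ((+ b - t) + c) + + 1) (sym (pos-+ 1 (suc a))) ⟩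
  ((+ b - + suc (suc a)) + c) + + 1     ∎
  where
  open ≡-Reasoning
  shift : ∀ x y z → (x - y) + z ≡ ((x - (+ 1 + y)) + z) + + 1
  shift = solve-∀

content-left : ∀ c a b → content c (a , suc (suc b)) ≡ content c (a , suc b) + + 1
content-left c a b = begin
  (+ suc (suc b) - + a) + c             ≡⟨ cong (λ t → (t - + a) + c) (pos-+ 1 (suc b)) ⟩
  ((+ 1 + + suc b) - + a) + c           ≡⟨ shift (+ suc b) (+ a) c ⟩
  ((+ suc b - + a) + c) + + 1           ∎
  where
  open ≡-Reasoning
  shift : ∀ x y z → ((+ 1 + x) - y) + z ≡ ((x - y) + z) + + 1
  shift = solve-∀

residue-⋖ : ∀ e .{{_ : NonZero e}} → 2 ≤ e → ∀ c {γ δ} → γ ⋖ δ → residue e c γ ≢ residue e c δ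
residue-⋖ e 2≤e c (above {a} {b}) eq =
  [z+1]%e≢z%e e 2≤e (content c (suc (suc a) , b))
    (trans (cong (λ t → t %ℕ e) (sym (content-above c a b))) eq)
residue-⋖ e 2≤e c (left {a} {b}) eq =
  [z+1]%e≢z%e e 2≤e (content c (a , suc b))
    (trans (cong (λ t → t %ℕ e) (sym (content-left c a b))) (sym eq))

diagram : List ℕ → NodeSet
diagram xs (a , b) = (1 ≤ a × a ≤ length xs) × (1 ≤ b × b ≤ partL xs a)

diagram-[] : ∀ {γ} → ¬ diagram [] γ
diagram-[] ((s≤s _ , ()) , _)

diagram-∷⁻ : ∀ x xs {a b} → diagram (x ∷ xs) (suc (suc a) , b) → diagram xs (suc a , b)
diagram-∷⁻ _ _ ((_ , s≤s a≤) , b-bounds) = (s≤s z≤n , a≤) , b-bounds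

diagram-∷⁺ : ∀ x xs {a b} → diagram xs (suc a , b) → diagram (x ∷ xs) (suc (suc a) , b)
diagram-∷⁺ _ _ ((_ , a≤) , b-bounds) = (s≤s z≤n , s≤s a≤) , b-bounds

partL-≤-head : ∀ {x xs} → Linked _≥_ (x ∷ xs) → ∀ k → partL (x ∷ xs) (suc k) ≤ x
partL-≤-head                    _         zero    = ≤-refl
partL-≤-head {xs = []}          _         (suc k) = z≤n
partL-≤-head {xs = y ∷ ys}      (x≥y ∷ l) (suc k) = ≤-trans (partL-≤-head l k) x≥y

partL-suc-≤ : ∀ {xs} → Linked _≥_ xs → ∀ k → partL xs (suc (suc k)) ≤ partL xs (suc k)
partL-suc-≤ {[]}             _         _       = z≤n
partL-suc-≤ {_ ∷ []}         _         _       = z≤n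
partL-suc-≤ {_ ∷ _ ∷ _}      (x≥y ∷ _) zero    = x≥y
partL-suc-≤ {_ ∷ y ∷ ys}     (_ ∷ l)   (suc k) = partL-suc-≤ l k

diagram-⋖-closed : ∀ {xs γ δ} → Linked _≥_ xs → γ ⋖ δ → diagram xs δ → diagram xs γ
diagram-⋖-closed l (above {a}) ((_ , a≤) , (1≤b , b≤)) =
  (s≤s z≤n , ≤-trans (n≤1+n _) a≤) , (1≤b , ≤-trans b≤ (partL-suc-≤ l a))
diagram-⋖-closed l left (a-bounds , (_ , b≤)) = a-bounds , (s≤s z≤n , ≤-trans (n≤1+n _) b≤)

Supported : NodeSet → Node → Set
Supported S (a , b) = (1 ≤ a × 1 ≤ b) × (∀ {γ} → γ ⋖ (a , b) → S γ)

Supported-map : ∀ {S T : NodeSet} {δ} → (∀ {γ} → γ ⋖ δ → S γ → T γ) → Supported S δ → Supported T δ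
Supported-map {δ = _ , _} f (positive , neighbours) = positive , λ γ⋖δ → f γ⋖δ (neighbours γ⋖δ)

diagram⇒Supported : ∀ {xs δ} → Linked _≥_ xs → diagram xs δ → Supported (diagram xs) δ
diagram⇒Supported {δ = _ , _} l δ∈ =
  (proj₁ (proj₁ δ∈) , proj₁ (proj₂ δ∈)) , λ γ⋖δ → diagram-⋖-closed l γ⋖δ δ∈

-- addToRow xs k adds a node at the end of row k (counted from 0) of the diagram of xs.
addToRow : List ℕ → ℕ → List ℕ
addToRow []       _       = 1 ∷ []
addToRow (x ∷ xs) zero    = suc x ∷ xs
addToRow (x ∷ xs) (suc k) = x ∷ addToRow xs k

-- Corner xs k b : the node (suc k , b) is an outer corner of the diagram of xs.
data Corner : List ℕ → ℕ → ℕ → Set where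
  here-[] : Corner [] zero 1
  here-∷  : ∀ {x xs} → Corner (x ∷ xs) zero (suc x)
  there   : ∀ {x xs k b} → Corner xs k b → b ≤ x → Corner (x ∷ xs) (suc k) b

addToRow-linked : ∀ {xs k b} → Corner xs k b → Linked _≥_ xs → Linked _≥_ (addToRow xs k)
addToRow-linked here-[]                   _         = [-]
addToRow-linked here-∷                    [-]       = [-]
addToRow-linked here-∷                    (x≥y ∷ l) = m≤n⇒m≤1+n x≥y ∷ l
addToRow-linked (there here-[] b≤x)       _         = b≤x ∷ [-]
addToRow-linked (there here-∷ b≤x)        (_ ∷ l)   = b≤x ∷ addToRow-linked here-∷ l
addToRow-linked (there c@(there _ _) _)   (x≥y ∷ l) = x≥y ∷ addToRow-linked c l

addToRow-positive : ∀ {xs k b} → Corner xs k b → All (_> 0) xs → All (_> 0) (addToRow xs k)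
addToRow-positive here-[]     []       = s≤s z≤n ∷ []
addToRow-positive here-∷      (_ ∷ ps) = s≤s z≤n ∷ ps
addToRow-positive (there c _) (p ∷ ps) = p ∷ addToRow-positive c ps

diagram-addToRow⁺ : ∀ {xs k b} → Corner xs k b → ∀ γ →
                    diagram xs γ ⊎ γ ≡ (suc k , b) → diagram (addToRow xs k) γ
diagram-addToRow⁺ here-[]     _ (inj₂ refl) = (s≤s z≤n , s≤s z≤n) , (s≤s z≤n , s≤s z≤n)
diagram-addToRow⁺ here-∷      _ (inj₂ refl) = (s≤s z≤n , s≤s z≤n) , (s≤s z≤n , ≤-refl)
diagram-addToRow⁺ (there {x} {xs} {k} c _) _ (inj₂ refl) =
  diagram-∷⁺ x (addToRow xs k) (diagram-addToRow⁺ c _ (inj₂ refl))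
diagram-addToRow⁺ here-[]     (_ , _)            (inj₁ ((s≤s _ , ()) , _))
diagram-addToRow⁺ here-∷      (suc zero , _)     (inj₁ (a-bounds , (1≤b , b≤x))) =
  a-bounds , (1≤b , m≤n⇒m≤1+n b≤x)
diagram-addToRow⁺ here-∷      (suc (suc _) , _)  (inj₁ γ∈) = γ∈
diagram-addToRow⁺ (there _ _) (suc zero , _)     (inj₁ (_ , b-bounds)) = (s≤s z≤n , s≤s z≤n) , b-bounds
diagram-addToRow⁺ (there {x} {xs} {k} c _) (suc (suc _) , _) (inj₁ γ∈) =
  diagram-∷⁺ x (addToRow xs k) (diagram-addToRow⁺ c _ (inj₁ (diagram-∷⁻ x xs γ∈)))
diagram-addToRow⁺ _           (zero , _)         (inj₁ ((() , _) , _))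

diagram-addToRow⁻ : ∀ {xs k b} → Corner xs k b → ∀ γ →
                    diagram (addToRow xs k) γ → diagram xs γ ⊎ γ ≡ (suc k , b)
diagram-addToRow⁻ _           (zero , _)          ((() , _) , _)
diagram-addToRow⁻ here-[]     (suc zero , _)      (_ , (s≤s z≤n , s≤s z≤n)) = inj₂ refl
diagram-addToRow⁻ here-[]     (suc (suc _) , _)   ((_ , s≤s ()) , _)
diagram-addToRow⁻ (here-∷ {x}) (suc zero , b)     (a-bounds , (1≤b , b≤1+x)) with b ≤? x
... | yes b≤x = inj₁ (a-bounds , (1≤b , b≤x))
... | no  b≰x = inj₂ (cong (1 ,_) (≤-antisym b≤1+x (≰⇒> b≰x)))
diagram-addToRow⁻ here-∷      (suc (suc _) , _)   γ∈ = inj₁ γ∈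
diagram-addToRow⁻ (there _ _) (suc zero , _)      (_ , b-bounds) = inj₁ ((s≤s z≤n , s≤s z≤n) , b-bounds)
diagram-addToRow⁻ (there {x} {xs} {k} c _) (suc (suc a) , b) γ∈ =
  Sum.map (diagram-∷⁺ x xs) (cong (map₁ suc))
    (diagram-addToRow⁻ c (suc a , b) (diagram-∷⁻ x (addToRow xs k) γ∈))

Supported⇒Corner : ∀ {xs k b} → Linked _≥_ xs → All (_> 0) xs →
                   ¬ diagram xs (suc k , b) → Supported (diagram xs) (suc k , b) → Corner xs k b
Supported⇒Corner {b = zero} _ _ _ ((_ , ()) , _)
Supported⇒Corner {[]} {zero} {suc zero} _ _ _ _ = here-[]
Supported⇒Corner {[]} {zero} {suc (suc _)} _ _ _ (_ , neighbours) = ⊥-elim (diagram-[] (neighbours left))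
Supported⇒Corner {[]} {suc _} _ _ _ (_ , neighbours) = ⊥-elim (diagram-[] (neighbours above))
Supported⇒Corner {_ ∷ _} {zero} {suc zero} _ (x>0 ∷ _) ∉ _ =
  ⊥-elim (∉ ((s≤s z≤n , s≤s z≤n) , (s≤s z≤n , x>0)))
Supported⇒Corner {x ∷ xs} {zero} {suc (suc m)} _ _ ∉ (_ , neighbours) =
  subst (Corner (x ∷ xs) zero) 1+x≡b here-∷
  where
  1+x≡b : suc x ≡ suc (suc m)
  1+x≡b = ≤-antisym (≰⇒> (λ b≤x → ∉ ((s≤s z≤n , s≤s z≤n) , (s≤s z≤n , b≤x))))
                    (s≤s (proj₂ (proj₂ (neighbours left))))
Supported⇒Corner {x ∷ xs} {suc k} {b} l ps ∉ ((_ , 1≤b) , neighbours) =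
  there (Supported⇒Corner (Linked.tail l) (All.tail ps) (∉ ∘ diagram-∷⁺ x xs)
                          ((s≤s z≤n , 1≤b) , tail-neighbours))
        (≤-trans (proj₂ (proj₂ (neighbours above))) (partL-≤-head l k))
  where
  tail-neighbours : ∀ {γ} → γ ⋖ (suc k , b) → diagram xs γ
  tail-neighbours above = diagram-∷⁻ x xs (neighbours above)
  tail-neighbours left  = diagram-∷⁻ x xs (neighbours left)

Y? : (p : Partition) → ∀ γ → Dec (Y p γ)
Y? p (a , b) = ((1 ≤? a) ×-dec (a ≤? length (parts p))) ×-dec ((1 ≤? b) ×-dec (b ≤? part p a))

Y⇒Supported : (p : Partition) → ∀ {γ} → Y p γ → Supported (Y p) γ
Y⇒Supported p = diagram⇒Supported (decr p)

Supported⇒Addable : (p : Partition) → ∀ {γ} → ¬ Y p γ → Supported (Y p) γ → Addable p γ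
Supported⇒Addable p {zero , _} _ ((() , _) , _)
Supported⇒Addable p {suc k , b} ∉ s =
  ∉ , (ν , λ γ → mk⇔ (diagram-addToRow⁺ corner γ) (diagram-addToRow⁻ corner γ))
  where
  corner : Corner (parts p) k b
  corner = Supported⇒Corner (decr p) (pos p) ∉ s
  ν : Partition
  ν = record { parts = addToRow (parts p) k
             ; decr  = addToRow-linked corner (decr p)
             ; pos   = addToRow-positive corner (pos p)
             }

Addable⇒Supported : (p : Partition) → ∀ {γ} → Addable p γ → Supported (Y p) γ
Addable⇒Supported p {γ} (_ , (ν , Y⇔)) =
  Supported-map below (Y⇒Supported ν (Equivalence.to (Y⇔ γ) (inj₂ refl)))
  where
  below : ∀ {γ'} → γ' ⋖ γ → Y ν γ' → Y p γ'
  below {γ'} γ'⋖γ γ'∈ν with Equivalence.from (Y⇔ γ') γ'∈ν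
  ... | inj₁ γ'∈p = γ'∈p
  ... | inj₂ refl = ⊥-elim (⋖-irrefl γ'⋖γ)

Supported-i-node-∈ : ∀ e .{{_ : NonZero e}} c i (μ : Partition) →
                     ¬ (∃ λ γ → Addable μ γ × IsINode e c i γ) →
                     ∀ {γ} → IsINode e c i γ → Supported (Y μ) γ → Y μ γ
Supported-i-node-∈ e c i μ no-addable {γ} γ-i s =
  decidable-stable (Y? μ γ) (λ ∉ → no-addable (γ , Supported⇒Addable μ ∉ s , γ-i))

lemma3p7 : (e : ℕ) .{{_ : NonZero e}} → 2 ≤ e → (c : ℤ) → (i : ℕ) → i < e →
    (lam mu slam : Partition) → IsCore e c lam → IsCore e c mu →
    ¬ (∃ λ γ → Addable mu γ × IsINode e c i γ) →
    IsSiAction e c i lam slam →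
    (Y lam ⊆ Y mu) ⇔ (Y slam ⊆ Y mu)
lemma3p7 e 2≤e c i _ lam mu slam _ _ no-addable (adding , removing) = mk⇔ forward backward
  where
  open Equivalence
  fill : ∀ {γ} → IsINode e c i γ → Supported (Y mu) γ → Y mu γ
  fill = Supported-i-node-∈ e c i mu no-addable

  -- Whether λ has an addable i-node is not decidable, but membership in Y(μ) is.
  forward : Y lam ⊆ Y mu → Y slam ⊆ Y mu
  forward lam⊆mu γ γ∈slam = by-cases (Y? mu γ)
    (λ adds → [ lam⊆mu γ , added ] (to (adding adds γ) γ∈slam))
    (λ removes → lam⊆mu γ (proj₁ (to (removing removes γ) γ∈slam)))
    where
    added : Addable lam γ × IsINode e c i γ → Y mu γ
    added (γ-addable , γ-i) =
      fill γ-i (Supported-map (λ _ → lam⊆mu _) (Addable⇒Supported lam γ-addable))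

  backward : Y slam ⊆ Y mu → Y lam ⊆ Y mu
  backward slam⊆mu γ γ∈lam = by-cases (Y? mu γ)
    (λ adds → slam⊆mu γ (from (adding adds γ) (inj₁ γ∈lam)))
    (λ removes → by-cases (Y? mu γ)
      (λ γ-i → fill γ-i (Supported-map (kept removes γ-i) (Y⇒Supported lam γ∈lam)))
      (λ γ-not-i → slam⊆mu γ (from (removing removes γ) (γ∈lam , γ-not-i ∘ proj₂))))
    where
    kept : ¬ (∃ λ δ → Addable lam δ × IsINode e c i δ) → IsINode e c i γ →
           ∀ {γ'} → γ' ⋖ γ → Y lam γ' → Y mu γ'
    kept removes γ-i γ'⋖γ γ'∈lam = slam⊆mu _ (from (removing removes _)
      (γ'∈lam , λ (_ , γ'-i) → residue-⋖ e 2≤e c γ'⋖γ (trans γ'-i (sym γ-i))))
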